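{- Let $n$ be an odd prime and let $x, y, z$ be pairwise relatively prime positive integers satisfying $x^n + y^n = z^n$. Then: (a) every odd prime $p \mid x$ satisfies $\nu_p(z^{p-1} - y^{p-1}) \geq n - 1$; every odd prime $p \mid y$ satisfies $\nu_p(z^{p-1} - x^{p-1}) \geq n - 1$; every odd prime $p \mid z$ satisfies $\nu_p(x^{p-1} - y^{p-1}) \geq n - 1$ (i.e. each such $p$ is a Wieferich prime of order at least $n-1$ to the complementary base pair); (b) if moreover $n \nmid xyz$, then the lower bound $n-1$ in (a) can be replaced by $n$; (c) if $2 \mid z$ then $\nu_2(x + y) \geq n$; if $2 \mid x$ then $\nu_2(z - y) \geq n$; if $2 \mid y$ then $\nu_2(z - x) \geq n$; (d) if an odd prime $p$ divides $x$ and also divides $z - y$, then $\nu_p(z - y) \geq n - 1$; if an odd prime $p$ divides $y$ and also divides $z - x$, then $\nu_p(z - x) \geq n - 1$; if an odd prime $p$ divides $z$ and also divides $x + y$, then $\nu_p(x + y) \geq n - 1$.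
   Context: For a prime $p$ and a nonzero integer $m$, $\nu_p(m)$ denotes the $p$-adic valuation of $m$. A prime $p \nmid ab$ is called a Wieferich prime to the base $(a,b)$ of order $r$ if $\nu_p(a^{p-1} - b^{p-1}) = r > 1$. -}

module Defs where

open import Data.Nat using (ℕ; _^_; _∸_; _+_)
open import Data.Nat.Divisibility using (_∣_)
open import Data.Nat.Primality using (Prime)
open import Data.Integer as ℤ using (ℤ; ∣_∣; +_)
open import Relation.Nullary using (¬_)
open import Data.Product using (_×_)

-- ValGe p m k  :  ν_p(m) ≥ k, i.e. p^k divides m (with ν_p(0) = ∞).
ValGe : ℕ → ℤ → ℕ → Set
ValGe p m k = p ^ k ∣ ∣ m ∣

OddPrime : ℕ → Set
OddPrime p = Prime p × ¬ (2 ∣ p)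

powDiff : ℕ → ℕ → ℕ → ℤ
powDiff a b e = (+ (a ^ e)) ℤ.- (+ (b ^ e))

diff : ℕ → ℕ → ℤ
diff a b = (+ a) ℤ.- (+ b)

{-# OPTIONS --safe #-}
module Submission where

-- If p ∣ c and aⁿ − bⁿ = cⁿ, then pⁿ divides aⁿ − bⁿ = (a − b)·S with S = Σ aⁿ⁻¹⁻ⁱ bⁱ. When p ∣ a − b,
-- writing a = b + w gives S ≡ n bⁿ⁻¹ + (n C 2) w bⁿ⁻² (mod w²); so p ∤ S unless p = n, and since the odd
-- prime n divides n C 2, S ≡ n bⁿ⁻¹ (mod n²) is not divisible by n². Hence ν_p(a − b) ≥ n, or ≥ n − 1
-- when p = n. This is (d), and (c) with p = 2, where a and b are odd. For (a) and (b) the same bound is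
-- applied to a^(p−1) and b^(p−1): both are ≡ 1 (mod p) by Fermat's little theorem, and aⁿ − bⁿ divides
-- (a^(p−1))ⁿ − (b^(p−1))ⁿ. The three instances are zⁿ − yⁿ = xⁿ, zⁿ − xⁿ = yⁿ and xⁿ − (−y)ⁿ = zⁿ.

module LittleFermat where

  open import Data.Nat
  open import Data.Nat.Properties
  open import Data.Nat.Divisibility
  open import Data.Nat.Primality
  open import Data.Nat.Combinatorics using (_C_; nCk+nC[k+1]≡[n+1]C[k+1]; nCn≡1; nC1≡n; k>n⇒nCk≡0)
  open import Data.Nat.Tactic.RingSolver using (solve-∀)
  open import Data.Product
  open import Data.Sum
  open import Relation.Nullary
  open import Relation.Binary.PropositionalEquality

  [1+k]*[n+1]C[k+1]≡[n+1]*nCk : ∀ n k → suc k * (suc n C suc k) ≡ suc n * (n C k)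
  [1+k]*[n+1]C[k+1]≡[n+1]*nCk zero    zero    = refl
  [1+k]*[n+1]C[k+1]≡[n+1]*nCk zero    (suc k) = begin
    suc (suc k) * (1 C suc (suc k)) ≡⟨ cong (suc (suc k) *_) (k>n⇒nCk≡0 {1} {suc (suc k)} (s≤s (s≤s z≤n))) ⟩
    suc (suc k) * 0                 ≡⟨ *-zeroʳ (suc (suc k)) ⟩
    0                               ≡⟨ cong (1 *_) (k>n⇒nCk≡0 {0} {suc k} (s≤s z≤n)) ⟨
    1 * (0 C suc k)                 ∎
    where open ≡-Reasoning
  [1+k]*[n+1]C[k+1]≡[n+1]*nCk (suc n) zero    = begin
    1 * (suc (suc n) C 1) ≡⟨ *-identityˡ _ ⟩
    suc (suc n) C 1       ≡⟨ nC1≡n (suc (suc n)) ⟩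
    suc (suc n)           ≡⟨ *-identityʳ (suc (suc n)) ⟨
    suc (suc n) * 1       ∎
    where open ≡-Reasoning
  [1+k]*[n+1]C[k+1]≡[n+1]*nCk (suc n) (suc k) = begin
    suc (suc k) * (suc (suc n) C suc (suc k))
      ≡⟨ cong (suc (suc k) *_) (nCk+nC[k+1]≡[n+1]C[k+1] (suc n) (suc k)) ⟨
    suc (suc k) * (A + B)
      ≡⟨ distrib-lemma k A B ⟩
    A + (suc k * A + suc (suc k) * B)
      ≡⟨ cong (λ t → A + t) (cong₂ _+_ ([1+k]*[n+1]C[k+1]≡[n+1]*nCk n k) ([1+k]*[n+1]C[k+1]≡[n+1]*nCk n (suc k))) ⟩
    A + (suc n * (n C k) + suc n * (n C suc k))
      ≡⟨ cong (λ t → A + t) (*-distribˡ-+ (suc n) (n C k) (n C suc k)) ⟨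
    A + suc n * (n C k + n C suc k)
      ≡⟨ cong (λ t → A + suc n * t) (nCk+nC[k+1]≡[n+1]C[k+1] n k) ⟩
    A + suc n * A
      ∎
    where
    open ≡-Reasoning
    A = suc n C suc k
    B = suc n C suc (suc k)
    distrib-lemma : ∀ k A B → (2 + k) * (A + B) ≡ A + ((1 + k) * A + (2 + k) * B)
    distrib-lemma = solve-∀

  prime∣pCk : ∀ {p k} → Prime p → 0 < k → k < p → p ∣ p C k
  prime∣pCk {suc p} {suc k} p-prime _ k<p
    with euclidsLemma (suc k) (suc p C suc k) p-prime
           (divides (p C k) (trans ([1+k]*[n+1]C[k+1]≡[n+1]*nCk p k) (*-comm (suc p) (p C k))))
  ... | inj₂ p∣pCk = p∣pCk
  ... | inj₁ p∣k   = contradiction (∣⇒≤ p∣k) (<⇒≱ k<p)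

  binomialSum : ℕ → ℕ → ℕ → ℕ
  binomialSum n a zero    = 0
  binomialSum n a (suc j) = binomialSum n a j + (n C j) * a ^ j

  binomialSum-pascal : ∀ n a j → binomialSum (suc n) a (suc j) ≡ binomialSum n a (suc j) + a * binomialSum n a j
  binomialSum-pascal n a zero    = sym (cong (1 +_) (*-zeroʳ a))
  binomialSum-pascal n a (suc j) = begin
    binomialSum (suc n) a (suc j) + (suc n C suc j) * a ^ suc j
      ≡⟨ cong (_+ (suc n C suc j) * a ^ suc j) (binomialSum-pascal n a j) ⟩
    (S₁ + a * S₀) + (suc n C suc j) * a ^ suc j
      ≡⟨ cong (λ c → (S₁ + a * S₀) + c * a ^ suc j) (nCk+nC[k+1]≡[n+1]C[k+1] n j) ⟨
    (S₁ + a * S₀) + (n C j + n C suc j) * (a * a ^ j)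
      ≡⟨ regroup S₁ S₀ (n C j) (n C suc j) a (a ^ j) ⟩
    (S₁ + (n C suc j) * (a * a ^ j)) + a * (S₀ + (n C j) * a ^ j) ∎
    where
    open ≡-Reasoning
    S₀ = binomialSum n a j
    S₁ = binomialSum n a (suc j)
    regroup : ∀ X Y c₁ c₂ a A → (X + a * Y) + (c₁ + c₂) * (a * A) ≡ (X + c₂ * (a * A)) + a * (Y + c₁ * A)
    regroup = solve-∀

  binomial-theorem : ∀ n a → (1 + a) ^ n ≡ binomialSum n a (suc n)
  binomial-theorem zero    a = refl
  binomial-theorem (suc n) a = begin
    (1 + a) * (1 + a) ^ n                  ≡⟨ cong ((1 + a) *_) (binomial-theorem n a) ⟩
    (1 + a) * S                            ≡⟨ expand S a (a ^ suc n) ⟩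
    (S + 0 * a ^ suc n) + a * S            ≡⟨ cong (λ c → (S + c * a ^ suc n) + a * S) (k>n⇒nCk≡0 (n<1+n n)) ⟨
    (S + (n C suc n) * a ^ suc n) + a * S  ≡⟨ binomialSum-pascal n a (suc n) ⟨
    binomialSum (suc n) a (suc (suc n))    ∎
    where
    open ≡-Reasoning
    S = binomialSum n a (suc n)
    expand : ∀ S a A → (1 + a) * S ≡ (S + 0 * A) + a * S
    expand = solve-∀

  binomialSum-prime≡1 : ∀ {p} a j → Prime p → j < p → ∃[ q ] binomialSum p a (suc j) ≡ 1 + q * p
  binomialSum-prime≡1 a zero    _       _   = 0 , refl
  binomialSum-prime≡1 {p} a (suc j) p-prime j<p
    with binomialSum-prime≡1 a j p-prime (<⇒≤ j<p) | prime∣pCk p-prime (s≤s z≤n) j<p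
  ... | q , eq | divides r pCk≡r*p = q + r * a ^ suc j , (begin
    binomialSum p a (suc j) + (p C suc j) * a ^ suc j ≡⟨ cong₂ _+_ eq (cong (_* a ^ suc j) pCk≡r*p) ⟩
    (1 + q * p) + r * p * a ^ suc j                   ≡⟨ collect q p r (a ^ suc j) ⟩
    1 + (q + r * a ^ suc j) * p                       ∎)
    where
    open ≡-Reasoning
    collect : ∀ q p r A → (1 + q * p) + r * p * A ≡ 1 + (q + r * A) * p
    collect = solve-∀

  fermat-little : ∀ {p} a → Prime p → ∃[ q ] a ^ p ≡ a + q * p
  fermat-little {suc p} zero    _       = 0 , refl
  fermat-little {suc p} (suc a) p-prime
    with fermat-little a p-prime | binomialSum-prime≡1 a p p-prime ≤-refl
  ... | q , aᵖ≡ | q′ , sum≡ = q′ + q , (begin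
    (1 + a) ^ suc p
      ≡⟨ binomial-theorem (suc p) a ⟩
    binomialSum (suc p) a (suc p) + (suc p C suc p) * a ^ suc p
      ≡⟨ cong₂ _+_ sum≡ (cong₂ _*_ (nCn≡1 (suc p)) aᵖ≡) ⟩
    (1 + q′ * suc p) + 1 * (a + q * suc p)
      ≡⟨ collect q′ q a (suc p) ⟩
    suc a + (q′ + q) * suc p
      ∎)
    where
    open ≡-Reasoning
    collect : ∀ q′ q a P → (1 + q′ * P) + 1 * (a + q * P) ≡ (1 + a) + (q′ + q) * P
    collect = solve-∀

module PrimeDivisibility where

  open import Defs using (OddPrime)

  open import Data.Nat
  open import Data.Nat.Properties
  open import Data.Nat.Divisibility
  open import Data.Nat.DivMod using (_%_; _/_; m≡m%n+[m/n]*n; m%n<n)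
  open import Data.Nat.Primality
  open import Data.Nat.Coprimality using (Coprime)
  open import Data.Product
  open import Data.Sum
  open import Relation.Nullary
  open import Relation.Binary.PropositionalEquality

  ^-monoʳ-∣ : ∀ m {i j} → i ≤ j → m ^ i ∣ m ^ j
  ^-monoʳ-∣ m {i} {j} i≤j = divides (m ^ (j ∸ i)) (begin
    m ^ j               ≡⟨ cong (m ^_) (m+[n∸m]≡n i≤j) ⟨
    m ^ (i + (j ∸ i))   ≡⟨ ^-distribˡ-+-* m i (j ∸ i) ⟩
    m ^ i * m ^ (j ∸ i) ≡⟨ *-comm (m ^ i) _ ⟩
    m ^ (j ∸ i) * m ^ i ∎)
    where open ≡-Reasoning

  ^-monoˡ-∣ : ∀ {m n} k → m ∣ n → m ^ k ∣ n ^ k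
  ^-monoˡ-∣ zero    _   = ∣-refl
  ^-monoˡ-∣ (suc k) m∣n = *-pres-∣ m∣n (^-monoˡ-∣ k m∣n)

  prime∣m^k⇒prime∣m : ∀ {p m} k → Prime p → p ∣ m ^ k → p ∣ m
  prime∣m^k⇒prime∣m zero    p-prime p∣1 = contradiction (∣1⇒≡1 p∣1) (nonTrivial⇒≢1 {{prime⇒nonTrivial p-prime}})
  prime∣m^k⇒prime∣m (suc k) p-prime p∣m*mᵏ with euclidsLemma _ _ p-prime p∣m*mᵏ
  ... | inj₁ p∣m   = p∣m
  ... | inj₂ p∣mᵏ = prime∣m^k⇒prime∣m k p-prime p∣mᵏ

  p^k∣m*n∧p∤n⇒p^k∣m : ∀ {p m n} k → Prime p → ¬ p ∣ n → p ^ k ∣ m * n → p ^ k ∣ m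
  p^k∣m*n∧p∤n⇒p^k∣m         zero    _       _   _           = 1∣ _
  p^k∣m*n∧p∤n⇒p^k∣m {p} {m} {n} (suc k) p-prime p∤n p*pᵏ∣m*n
    with euclidsLemma m n p-prime (∣-trans (m∣m*n (p ^ k)) p*pᵏ∣m*n)
  ... | inj₂ p∣n = contradiction p∣n p∤n
  ... | inj₁ (divides q refl) =
    subst (p * p ^ k ∣_) (*-comm p q) (*-monoʳ-∣ p (p^k∣m*n∧p∤n⇒p^k∣m k p-prime p∤n pᵏ∣q*n))
    where
    pᵏ∣q*n : p ^ k ∣ q * n
    pᵏ∣q*n = *-cancelˡ-∣ p {{prime⇒nonZero p-prime}}
      (subst (p * p ^ k ∣_) (trans (cong (_* n) (*-comm q p)) (*-assoc p q n)) p*pᵏ∣m*n)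

  p^k∣m*n∧p²∤n⇒p^[k∸1]∣m : ∀ {p m n} k → Prime p → ¬ p * p ∣ n → p ^ k ∣ m * n → p ^ (k ∸ 1) ∣ m
  p^k∣m*n∧p²∤n⇒p^[k∸1]∣m {p} {m} {n} k p-prime p²∤n pᵏ∣m*n with p ∣? n
  ... | no p∤n = ∣-trans (^-monoʳ-∣ p (m∸n≤m k 1)) (p^k∣m*n∧p∤n⇒p^k∣m k p-prime p∤n pᵏ∣m*n)
  ... | yes (divides q refl) = cancel-p k pᵏ∣m*p
    where
    p∤q : ¬ p ∣ q
    p∤q (divides r refl) = p²∤n (divides r (*-assoc r p p))
    pᵏ∣m*p : p ^ k ∣ m * p
    pᵏ∣m*p = p^k∣m*n∧p∤n⇒p^k∣m k p-prime p∤q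
      (subst (p ^ k ∣_) (trans (cong (m *_) (*-comm q p)) (sym (*-assoc m p q))) pᵏ∣m*n)
    cancel-p : ∀ k → p ^ k ∣ m * p → p ^ (k ∸ 1) ∣ m
    cancel-p zero    _         = 1∣ m
    cancel-p (suc k) p*pᵏ∣m*p =
      *-cancelˡ-∣ p {{prime⇒nonZero p-prime}} (subst (p * p ^ k ∣_) (*-comm m p) p*pᵏ∣m*p)

  odd⇒≡1+2* : ∀ {n} → ¬ 2 ∣ n → ∃[ h ] n ≡ 1 + 2 * h
  odd⇒≡1+2* {n} 2∤n with n % 2 | m%n<n n 2 | m≡m%n+[m/n]*n n 2
  ... | 0 | _ | n≡[n/2]*2 = contradiction (divides (n / 2) n≡[n/2]*2) 2∤n
  ... | 1 | _ | n≡1+[n/2]*2 = n / 2 , trans n≡1+[n/2]*2 (cong suc (*-comm (n / 2) 2))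
  ... | 2+ _ | s≤s (s≤s ()) | _

  oddPrime⇒≡3+ : ∀ {n} → OddPrime n → ∃[ m ] n ≡ 3 + m
  oddPrime⇒≡3+ {0}     (prime {{()}} _ , _)
  oddPrime⇒≡3+ {1}     (prime {{()}} _ , _)
  oddPrime⇒≡3+ {2}     (_ , 2∤2) = contradiction ∣-refl 2∤2
  oddPrime⇒≡3+ {suc (suc (suc m))} _ = m , refl

  prime∣prime⇒≡ : ∀ {p q} → Prime p → Prime q → p ∣ q → p ≡ q
  prime∣prime⇒≡ p-prime q-prime p∣q with prime⇒irreducible q-prime p∣q
  ... | inj₁ p≡1 = contradiction p≡1 (nonTrivial⇒≢1 {{prime⇒nonTrivial p-prime}})
  ... | inj₂ p≡q = p≡q

  coprime∧prime∣m⇒∤n : ∀ {p m n} → Prime p → Coprime m n → p ∣ m → ¬ p ∣ n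
  coprime∧prime∣m⇒∤n p-prime m⊥n p∣m p∣n = nonTrivial⇒≢1 {{prime⇒nonTrivial p-prime}} (m⊥n (p∣m , p∣n))

module PowerDifferences where

  open import Defs using (ValGe; OddPrime; powDiff)
  open import Data.Nat as ℕ using (ℕ; zero; suc; _∸_)
  import Data.Nat.Properties as ℕ
  open import Data.Nat.Divisibility using (_∣_; _∣?_; divides; ∣-trans)
  open import Data.Nat.Primality using (Prime; euclidsLemma; prime[2])
  open import Data.Nat.Combinatorics using (_C_; nC1≡n; nCk+nC[k+1]≡[n+1]C[k+1])
  open import Data.Integer.Base using (ℤ; +_; -_; _+_; _-_; _*_; _^_; ∣_∣; 0ℤ; 1ℤ; +[1+_]; -[1+_])
  open import Data.Integer.Properties using (abs-*; pos-+; pos-*; ^-*-assoc; *-zeroʳ; *-comm; +-identityˡ)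
  open import Data.Integer.DivMod using (_%ℕ_; _/ℕ_; n%ℕd<d; a≡a%ℕn+[a/ℕn]*n)
  open import Data.Integer.Divisibility.Signed using (∣ᵤ⇒∣; ∣⇒∣ᵤ; ∣m∣n⇒∣m-n; ∣m+n∣n⇒∣m; ∣m⇒∣m*n)
    renaming (_∣_ to _∣ℤ_; divides to dividesℤ; ∣-refl to ∣-reflℤ; *-cancelˡ-∣ to *-cancelˡ-∣ℤ)
  open import Data.Integer.Tactic.RingSolver using (solve-∀)
  open import Data.Product
  open import Data.Sum
  open import Relation.Nullary
  open import Relation.Binary.PropositionalEquality
  open LittleFermat
  open PrimeDivisibility

  pos-^ : ∀ m k → + (m ℕ.^ k) ≡ (+ m) ^ k
  pos-^ m zero    = refl
  pos-^ m (suc k) = trans (pos-* m (m ℕ.^ k)) (cong (+ m *_) (pos-^ m k))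

  abs-^ : ∀ i k → ∣ i ^ k ∣ ≡ ∣ i ∣ ℕ.^ k
  abs-^ i zero    = refl
  abs-^ i (suc k) = trans (abs-* i (i ^ k)) (cong (∣ i ∣ ℕ.*_) (abs-^ i k))

  ^-swap : ∀ i m k → (i ^ m) ^ k ≡ (i ^ k) ^ m
  ^-swap i m k = trans (^-*-assoc i m k) (trans (cong (i ^_) (ℕ.*-comm m k)) (sym (^-*-assoc i k m)))

  prime∣i^k⇒prime∣i : ∀ {p} i k → Prime p → p ∣ ∣ i ^ k ∣ → p ∣ ∣ i ∣
  prime∣i^k⇒prime∣i i k p-prime p∣iᵏ = prime∣m^k⇒prime∣m k p-prime (subst (_ ∣_) (abs-^ i k) p∣iᵏ)

  ∣∣⇒∣ℤ : ∀ {p} i → p ∣ ∣ i ∣ → + p ∣ℤ i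
  ∣∣⇒∣ℤ i = ∣ᵤ⇒∣ {i = i}

  valGe-^ : ∀ {p i} k → p ∣ ∣ i ∣ → ValGe p (i ^ k) k
  valGe-^ {p} {i} k p∣i = subst (p ℕ.^ k ∣_) (sym (abs-^ i k)) (^-monoˡ-∣ k p∣i)

  valGe-∣ : ∀ {p i j k} → ValGe p i k → i ∣ℤ j → ValGe p j k
  valGe-∣ pᵏ∣i i∣j = ∣-trans pᵏ∣i (∣⇒∣ᵤ i∣j)

  valGe-*-cancel : ∀ {p} i s k → Prime p → ¬ p ∣ ∣ s ∣ → ValGe p (i * s) k → ValGe p i k
  valGe-*-cancel i s k p-prime p∤s pᵏ∣is =
    p^k∣m*n∧p∤n⇒p^k∣m k p-prime p∤s (subst (_ ∣_) (abs-* i s) pᵏ∣is)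

  valGe-*-cancel² : ∀ {p} i s k → Prime p → ¬ p ℕ.* p ∣ ∣ s ∣ → ValGe p (i * s) k → ValGe p i (k ∸ 1)
  valGe-*-cancel² i s k p-prime p²∤s pᵏ∣is =
    p^k∣m*n∧p²∤n⇒p^[k∸1]∣m k p-prime p²∤s (subst (_ ∣_) (abs-* i s) pᵏ∣is)

  geometricSum : ℕ → ℤ → ℤ → ℤ
  geometricSum zero    u v = 0ℤ
  geometricSum (suc n) u v = u ^ n + v * geometricSum n u v

  ^-sub-^-factor : ∀ n u v → u ^ n - v ^ n ≡ (u - v) * geometricSum n u v
  ^-sub-^-factor zero    u v = sym (*-zeroʳ (u - v))
  ^-sub-^-factor (suc n) u v = begin
    u * u ^ n - v * v ^ n                  ≡⟨ telescope u v (u ^ n) (v ^ n) ⟩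
    (u - v) * u ^ n + v * (u ^ n - v ^ n)  ≡⟨ cong (λ t → (u - v) * u ^ n + v * t) (^-sub-^-factor n u v) ⟩
    (u - v) * u ^ n + v * ((u - v) * S)    ≡⟨ regroup u v (u ^ n) S ⟩
    (u - v) * (u ^ n + v * S)              ∎
    where
    open ≡-Reasoning
    S = geometricSum n u v
    telescope : ∀ u v U V → u * U - v * V ≡ (u - v) * U + v * (U - V)
    telescope = solve-∀
    regroup : ∀ u v U S → (u - v) * U + v * ((u - v) * S) ≡ (u - v) * (U + v * S)
    regroup = solve-∀

  sub∣^-sub-^ : ∀ n u v → u - v ∣ℤ u ^ n - v ^ n
  sub∣^-sub-^ n u v = dividesℤ (geometricSum n u v) (trans (^-sub-^-factor n u v) (*-comm (u - v) _))

  ^-sub-^≡sub*geometricSum : ∀ n u v → u ^ n - v ^ n ≡ (u - v) * geometricSum n (v + (u - v)) v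
  ^-sub-^≡sub*geometricSum n u v =
    trans (^-sub-^-factor n u v) (cong (λ t → (u - v) * geometricSum n t v) (u≡v+[u-v] u v))
    where
    u≡v+[u-v] : ∀ u v → u ≡ v + (u - v)
    u≡v+[u-v] = solve-∀

  binomial-mod-w² : ∀ m v w → ∃[ R ] (v + w) ^ suc m ≡ v ^ suc m + + suc m * w * v ^ m + w * w * R
  binomial-mod-w² zero    v w = 0ℤ , first v w
    where
    first : ∀ v w → (v + w) * 1ℤ ≡ v * 1ℤ + 1ℤ * w * 1ℤ + w * w * 0ℤ
    first = solve-∀
  binomial-mod-w² (suc m) v w with binomial-mod-w² m v w
  ... | R , eq = (v + w) * R + + suc m * v ^ m , trans (cong ((v + w) *_) eq) (step v w (v ^ m) (+ suc m) R)
    where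
    step : ∀ v w V M R → (v + w) * (v * V + M * w * V + w * w * R)
                       ≡ v * (v * V) + (1ℤ + M) * w * (v * V) + w * w * ((v + w) * R + M * V)
    step = solve-∀

  geometricSum-mod-w² : ∀ m v w → ∃[ R ] geometricSum (2 ℕ.+ m) (v + w) v
                                        ≡ + (2 ℕ.+ m) * v ^ suc m + w * (+ ((2 ℕ.+ m) C 2) * v ^ m + w * R)
  geometricSum-mod-w² zero    v w = 0ℤ , first v w
    where
    first : ∀ v w → (v + w) * 1ℤ + v * (1ℤ + v * 0ℤ) ≡ + 2 * (v * 1ℤ) + w * (+ 1 * 1ℤ + w * 0ℤ)
    first = solve-∀
  geometricSum-mod-w² (suc m) v w with binomial-mod-w² (suc m) v w | geometricSum-mod-w² m v w
  ... | R₁ , eq₁ | R₂ , eq₂ = R₁ + v * R₂ , (begin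
    (v + w) ^ (2 ℕ.+ m) + v * geometricSum (2 ℕ.+ m) (v + w) v
      ≡⟨ cong₂ (λ s t → s + v * t) eq₁ eq₂ ⟩
    (v * (v * V) + N * w * (v * V) + w * w * R₁) + v * (N * (v * V) + w * (T * V + w * R₂))
      ≡⟨ step v w V N T R₁ R₂ ⟩
    (1ℤ + N) * (v * (v * V)) + w * ((N + T) * (v * V) + w * (R₁ + v * R₂))
      ≡⟨ cong (λ c → (1ℤ + N) * (v * (v * V)) + w * (c * (v * V) + w * (R₁ + v * R₂))) N+T≡T′ ⟩
    (1ℤ + N) * (v * (v * V)) + w * (+ ((3 ℕ.+ m) C 2) * (v * V) + w * (R₁ + v * R₂)) ∎)
    where
    open ≡-Reasoning
    V = v ^ m
    N = + (2 ℕ.+ m)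
    T = + ((2 ℕ.+ m) C 2)
    N+T≡T′ : N + T ≡ + ((3 ℕ.+ m) C 2)
    N+T≡T′ = begin
      + (2 ℕ.+ m) + T                                ≡⟨ cong (λ c → + c + T) (nC1≡n (2 ℕ.+ m)) ⟨
      + ((2 ℕ.+ m) C 1) + T                          ≡⟨ pos-+ ((2 ℕ.+ m) C 1) ((2 ℕ.+ m) C 2) ⟨
      + ((2 ℕ.+ m) C 1 ℕ.+ (2 ℕ.+ m) C 2)            ≡⟨ cong +_ (nCk+nC[k+1]≡[n+1]C[k+1] (2 ℕ.+ m) 1) ⟩
      + ((3 ℕ.+ m) C 2)                              ∎
    step : ∀ v w V N T R₁ R₂
         → (v * (v * V) + N * w * (v * V) + w * w * R₁) + v * (N * (v * V) + w * (T * V + w * R₂))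
         ≡ (1ℤ + N) * (v * (v * V)) + w * ((N + T) * (v * V) + w * (R₁ + v * R₂))
    step = solve-∀

  p∤geometricSum : ∀ {p} m v w → Prime p → p ∣ ∣ w ∣ → ¬ p ∣ ∣ v ∣ → ¬ p ∣ 2 ℕ.+ m
                 → ¬ p ∣ ∣ geometricSum (2 ℕ.+ m) (v + w) v ∣
  p∤geometricSum {p} m v w p-prime p∣w p∤v p∤n p∣S =
    [ p∤n , (λ p∣vᵐ⁺¹ → p∤v (prime∣i^k⇒prime∣i v (suc m) p-prime p∣vᵐ⁺¹)) ]′ (euclidsLemma _ _ p-prime p∣n*vᵐ⁺¹)
    where
    p∣ℤn*vᵐ⁺¹ : + p ∣ℤ + (2 ℕ.+ m) * v ^ suc m
    p∣ℤn*vᵐ⁺¹ = ∣m+n∣n⇒∣m (subst (+ p ∣ℤ_) (proj₂ (geometricSum-mod-w² m v w)) (∣∣⇒∣ℤ _ p∣S))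
                          (∣m⇒∣m*n _ (∣∣⇒∣ℤ w p∣w))
    p∣n*vᵐ⁺¹ : p ∣ (2 ℕ.+ m) ℕ.* ∣ v ^ suc m ∣
    p∣n*vᵐ⁺¹ = subst (p ∣_) (abs-* (+ (2 ℕ.+ m)) (v ^ suc m)) (∣⇒∣ᵤ {+ p} p∣ℤn*vᵐ⁺¹)

  p²∤geometricSum : ∀ m v w → Prime (3 ℕ.+ m) → 3 ℕ.+ m ∣ ∣ w ∣ → ¬ 3 ℕ.+ m ∣ ∣ v ∣
                  → ¬ (3 ℕ.+ m) ℕ.* (3 ℕ.+ m) ∣ ∣ geometricSum (3 ℕ.+ m) (v + w) v ∣
  p²∤geometricSum m v w n-prime n∣w n∤v n²∣S
    with ∣∣⇒∣ℤ w n∣w | prime∣pCk {k = 2} n-prime (ℕ.s≤s ℕ.z≤n) (ℕ.s≤s (ℕ.s≤s (ℕ.s≤s ℕ.z≤n)))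
  ... | dividesℤ k refl | divides h nC2≡h*n =
    n∤v (prime∣i^k⇒prime∣i v (2 ℕ.+ m) n-prime (∣⇒∣ᵤ {P} (*-cancelˡ-∣ℤ P P*P∣P*vⁿ⁻¹)))
    where
    P = + (3 ℕ.+ m)
    R = proj₁ (geometricSum-mod-w² (suc m) v (k * P))
    S≡ : geometricSum (3 ℕ.+ m) (v + k * P) v ≡ P * v ^ (2 ℕ.+ m) + (P * P) * (k * (+ h * v ^ suc m + k * R))
    S≡ = begin
      geometricSum (3 ℕ.+ m) (v + k * P) v
        ≡⟨ proj₂ (geometricSum-mod-w² (suc m) v (k * P)) ⟩
      P * v ^ (2 ℕ.+ m) + k * P * (+ ((3 ℕ.+ m) C 2) * v ^ suc m + k * P * R)
        ≡⟨ cong (λ c → P * v ^ (2 ℕ.+ m) + k * P * (c * v ^ suc m + k * P * R))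
                (trans (cong +_ nC2≡h*n) (pos-* h (3 ℕ.+ m))) ⟩
      P * v ^ (2 ℕ.+ m) + k * P * (+ h * P * v ^ suc m + k * P * R)
        ≡⟨ factor-P² P (v ^ (2 ℕ.+ m)) k (+ h) (v ^ suc m) R ⟩
      P * v ^ (2 ℕ.+ m) + (P * P) * (k * (+ h * v ^ suc m + k * R)) ∎
      where
      open ≡-Reasoning
      factor-P² : ∀ P X k h Y R
                → P * X + k * P * (h * P * Y + k * P * R) ≡ P * X + (P * P) * (k * (h * Y + k * R))
      factor-P² = solve-∀
    P*P∣P*vⁿ⁻¹ : P * P ∣ℤ P * v ^ (2 ℕ.+ m)
    P*P∣P*vⁿ⁻¹ = ∣m+n∣n⇒∣m (subst (P * P ∣ℤ_) S≡ (∣∣⇒∣ℤ _ n²∣S)) (∣m⇒∣m*n _ ∣-reflℤ)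

  valGe-sub-^⇒valGe-sub-p∤n : ∀ {p e} m u v → Prime p → ¬ p ∣ 2 ℕ.+ m → p ∣ ∣ u - v ∣ → ¬ p ∣ ∣ v ∣
                             → ValGe p (u ^ (2 ℕ.+ m) - v ^ (2 ℕ.+ m)) e → ValGe p (u - v) e
  valGe-sub-^⇒valGe-sub-p∤n {p} {e} m u v p-prime p∤n p∣u-v p∤v pᵉ∣uⁿ-vⁿ =
    valGe-*-cancel (u - v) _ e p-prime (p∤geometricSum m v (u - v) p-prime p∣u-v p∤v p∤n)
      (subst (λ i → ValGe p i e) (^-sub-^≡sub*geometricSum (2 ℕ.+ m) u v) pᵉ∣uⁿ-vⁿ)

  valGe-sub-^⇒valGe-sub-p≡n : ∀ {e} m u v → Prime (3 ℕ.+ m) → 3 ℕ.+ m ∣ ∣ u - v ∣ → ¬ 3 ℕ.+ m ∣ ∣ v ∣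
                             → ValGe (3 ℕ.+ m) (u ^ (3 ℕ.+ m) - v ^ (3 ℕ.+ m)) e
                             → ValGe (3 ℕ.+ m) (u - v) (e ∸ 1)
  valGe-sub-^⇒valGe-sub-p≡n {e} m u v n-prime n∣u-v n∤v nᵉ∣uⁿ-vⁿ =
    valGe-*-cancel² (u - v) _ e n-prime (p²∤geometricSum m v (u - v) n-prime n∣u-v n∤v)
      (subst (λ i → ValGe (3 ℕ.+ m) i e) (^-sub-^≡sub*geometricSum (3 ℕ.+ m) u v) nᵉ∣uⁿ-vⁿ)

  ValGeBounds : ℕ → ℕ → ℤ → ℕ → Set
  ValGeBounds p n i e = (¬ p ∣ n → ValGe p i e) × ValGe p i (e ∸ 1)

  valGe-sub-^⇒valGe-sub : ∀ {n p e} u v → OddPrime n → Prime p → p ∣ ∣ u - v ∣ → ¬ p ∣ ∣ v ∣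
                          → ValGe p (u ^ n - v ^ n) e → ValGeBounds p n (u - v) e
  valGe-sub-^⇒valGe-sub {n} {p} {e} u v n-oddPrime p-prime p∣u-v p∤v pᵉ∣uⁿ-vⁿ
    with oddPrime⇒≡3+ n-oddPrime | p ∣? n
  ... | m , refl | no p∤n = (λ _ → pᵉ∣u-v) , ∣-trans (^-monoʳ-∣ p (ℕ.m∸n≤m e 1)) pᵉ∣u-v
    where pᵉ∣u-v = valGe-sub-^⇒valGe-sub-p∤n {e = e} (suc m) u v p-prime p∤n p∣u-v p∤v pᵉ∣uⁿ-vⁿ
  ... | m , refl | yes p∣n with prime∣prime⇒≡ p-prime (proj₁ n-oddPrime) p∣n
  ...   | refl = (λ p∤n → contradiction p∣n p∤n)
               , valGe-sub-^⇒valGe-sub-p≡n {e} m u v p-prime p∣u-v p∤v pᵉ∣uⁿ-vⁿ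

  ∣[i-1]∧∣[j-1]⇒∣[i-j] : ∀ {k} i j → k ∣ℤ i - 1ℤ → k ∣ℤ j - 1ℤ → k ∣ℤ i - j
  ∣[i-1]∧∣[j-1]⇒∣[i-j] {k} i j k∣i-1 k∣j-1 = subst (k ∣ℤ_) (cancel-1 i j) (∣m∣n⇒∣m-n k∣i-1 k∣j-1)
    where
    cancel-1 : ∀ i j → (i - 1ℤ) - (j - 1ℤ) ≡ i - j
    cancel-1 = solve-∀

  odd⇒2∣[i-1] : ∀ i → ¬ 2 ∣ ∣ i ∣ → + 2 ∣ℤ i - 1ℤ
  odd⇒2∣[i-1] i 2∤i with i %ℕ 2 | n%ℕd<d i 2 | a≡a%ℕn+[a/ℕn]*n i 2
  ... | 0 | _ | i≡0+q*2 = contradiction (∣⇒∣ᵤ {+ 2} (dividesℤ (i /ℕ 2) (trans i≡0+q*2 (+-identityˡ _)))) 2∤i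
  ... | 1 | _ | i≡1+q*2 = dividesℤ (i /ℕ 2) (trans (cong (_- 1ℤ) i≡1+q*2) (cancel-1 (i /ℕ 2)))
    where
    cancel-1 : ∀ q → (1ℤ + q * + 2) - 1ℤ ≡ q * + 2
    cancel-1 = solve-∀
  ... | suc (suc _) | ℕ.s≤s (ℕ.s≤s ()) | _

  even-^-neg : ∀ i h → (- i) ^ (2 ℕ.* h) ≡ i ^ (2 ℕ.* h)
  even-^-neg i h = trans (sym (^-*-assoc (- i) 2 h)) (trans (cong (_^ h) (square-neg i)) (^-*-assoc i 2 h))
    where
    square-neg : ∀ i → (- i) * ((- i) * 1ℤ) ≡ i * (i * 1ℤ)
    square-neg = solve-∀

  odd-^-neg : ∀ i h → (- i) ^ suc (2 ℕ.* h) ≡ - (i ^ suc (2 ℕ.* h))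
  odd-^-neg i h = trans (cong ((- i) *_) (even-^-neg i h)) (neg-* i (i ^ (2 ℕ.* h)))
    where
    neg-* : ∀ i j → (- i) * j ≡ - (i * j)
    neg-* = solve-∀

  even-^-abs : ∀ i h → (+ ∣ i ∣) ^ (2 ℕ.* h) ≡ i ^ (2 ℕ.* h)
  even-^-abs (+ n)    h = refl
  even-^-abs -[1+ n ] h = sym (even-^-neg +[1+ n ] h)

  fermat-little-ℤ : ∀ {p} i → OddPrime p → ¬ p ∣ ∣ i ∣ → + p ∣ℤ i ^ (p ∸ 1) - 1ℤ
  fermat-little-ℤ {p} i (p-prime , p-odd) p∤i with odd⇒≡1+2* p-odd
  ... | h , refl with fermat-little ∣ i ∣ p-prime
  ...   | q , aᵖ≡a+q*p with euclidsLemma a ∣ X ∣ p-prime (subst (p ∣_) (abs-* (+ a) X) (∣⇒∣ᵤ {+ p} p∣a*X))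
    where
    a = ∣ i ∣
    X = (+ a) ^ (2 ℕ.* h) - 1ℤ
    p∣a*X : + p ∣ℤ + a * X
    p∣a*X = dividesℤ (+ q) (begin
      + a * ((+ a) ^ (2 ℕ.* h) - 1ℤ)  ≡⟨ distrib (+ a) ((+ a) ^ (2 ℕ.* h)) ⟩
      (+ a) ^ p - + a                  ≡⟨ cong (_- + a) (pos-^ a p) ⟨
      + (a ℕ.^ p) - + a                ≡⟨ cong (λ t → + t - + a) aᵖ≡a+q*p ⟩
      + (a ℕ.+ q ℕ.* p) - + a          ≡⟨ cong (_- + a) (pos-+ a (q ℕ.* p)) ⟩
      (+ a + + (q ℕ.* p)) - + a        ≡⟨ cancel (+ a) (+ (q ℕ.* p)) ⟩
      + (q ℕ.* p)                      ≡⟨ pos-* q p ⟩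
      + q * + p                        ∎)
      where
      open ≡-Reasoning
      distrib : ∀ a A → a * (A - 1ℤ) ≡ a * A - a
      distrib = solve-∀
      cancel : ∀ a b → (a + b) - a ≡ b
      cancel = solve-∀
  ...     | inj₁ p∣a = contradiction p∣a p∤i
  ...     | inj₂ p∣X = subst (λ t → + p ∣ℤ t - 1ℤ) (even-^-abs i h) (∣∣⇒∣ℤ _ p∣X)

  wieferich-lift : ∀ {n p e} a b → OddPrime n → OddPrime p → ¬ p ∣ ∣ a ∣ → ¬ p ∣ ∣ b ∣
                 → ValGe p (a ^ n - b ^ n) e → ValGeBounds p n (a ^ (p ∸ 1) - b ^ (p ∸ 1)) e
  wieferich-lift {n} {p} {e} a b n-oddPrime p-oddPrime p∤a p∤b pᵉ∣aⁿ-bⁿ =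
    valGe-sub-^⇒valGe-sub {e = e} (a ^ k) (b ^ k) n-oddPrime (proj₁ p-oddPrime) p∣aᵏ-bᵏ p∤bᵏ pᵉ∣aᵏⁿ-bᵏⁿ
    where
    k = p ∸ 1
    p∣aᵏ-bᵏ : p ∣ ∣ a ^ k - b ^ k ∣
    p∣aᵏ-bᵏ = ∣⇒∣ᵤ {+ p} (∣[i-1]∧∣[j-1]⇒∣[i-j] (a ^ k) (b ^ k)
                (fermat-little-ℤ a p-oddPrime p∤a) (fermat-little-ℤ b p-oddPrime p∤b))
    p∤bᵏ : ¬ p ∣ ∣ b ^ k ∣
    p∤bᵏ p∣bᵏ = p∤b (prime∣i^k⇒prime∣i b k (proj₁ p-oddPrime) p∣bᵏ)
    pᵉ∣aᵏⁿ-bᵏⁿ : ValGe p ((a ^ k) ^ n - (b ^ k) ^ n) e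
    pᵉ∣aᵏⁿ-bᵏⁿ = valGe-∣ {p} {k = e} pᵉ∣aⁿ-bⁿ
      (subst₂ (λ s t → a ^ n - b ^ n ∣ℤ s - t) (^-swap a n k) (^-swap b n k) (sub∣^-sub-^ k (a ^ n) (b ^ n)))

  fermatEquation-rearranged : ∀ {n x y z} → ¬ 2 ∣ n → x ℕ.^ n ℕ.+ y ℕ.^ n ≡ z ℕ.^ n
    → ((+ z) ^ n - (+ y) ^ n ≡ (+ x) ^ n)
    × ((+ z) ^ n - (+ x) ^ n ≡ (+ y) ^ n)
    × ((+ x) ^ n - (- (+ y)) ^ n ≡ (+ z) ^ n)
  fermatEquation-rearranged {n} {x} {y} {z} n-odd xⁿ+yⁿ≡zⁿ =
      trans (cong (_- Y) (sym X+Y≡Z)) (cancelʳ X Y)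
    , trans (cong (_- X) (sym X+Y≡Z)) (cancelˡ X Y)
    , trans (cong (λ t → X - t) [-y]ⁿ≡-Y) (trans (sub-neg X Y) X+Y≡Z)
    where
    X = (+ x) ^ n
    Y = (+ y) ^ n
    X+Y≡Z : X + Y ≡ (+ z) ^ n
    X+Y≡Z = begin
      (+ x) ^ n + (+ y) ^ n       ≡⟨ cong₂ _+_ (pos-^ x n) (pos-^ y n) ⟨
      + (x ℕ.^ n) + + (y ℕ.^ n)   ≡⟨ pos-+ (x ℕ.^ n) (y ℕ.^ n) ⟨
      + (x ℕ.^ n ℕ.+ y ℕ.^ n)     ≡⟨ cong +_ xⁿ+yⁿ≡zⁿ ⟩
      + (z ℕ.^ n)                 ≡⟨ pos-^ z n ⟩
      (+ z) ^ n                   ∎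
      where open ≡-Reasoning
    [-y]ⁿ≡-Y : (- (+ y)) ^ n ≡ - Y
    [-y]ⁿ≡-Y with odd⇒≡1+2* n-odd
    ... | h , refl = odd-^-neg (+ y) h
    cancelʳ : ∀ X Y → (X + Y) - Y ≡ X
    cancelʳ = solve-∀
    cancelˡ : ∀ X Y → (X + Y) - X ≡ Y
    cancelˡ = solve-∀
    sub-neg : ∀ X Y → X - - Y ≡ X + Y
    sub-neg = solve-∀

  powDiff≡ : ∀ a b k → powDiff a b k ≡ (+ a) ^ k - (+ b) ^ k
  powDiff≡ a b k = cong₂ _-_ (pos-^ a k) (pos-^ b k)

  powDiff≡-neg : ∀ {p} a b → ¬ 2 ∣ p → powDiff a b (p ∸ 1) ≡ (+ a) ^ (p ∸ 1) - (- (+ b)) ^ (p ∸ 1)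
  powDiff≡-neg a b p-odd with odd⇒≡1+2* p-odd
  ... | h , refl =
    trans (powDiff≡ a b (2 ℕ.* h)) (cong (λ t → (+ a) ^ (2 ℕ.* h) - t) (sym (even-^-neg (+ b) h)))

  pos-+≡sub-neg : ∀ x y → + (x ℕ.+ y) ≡ (+ x) - (- (+ y))
  pos-+≡sub-neg x y = trans (pos-+ x y) (add≡sub-neg (+ x) (+ y))
    where
    add≡sub-neg : ∀ X Y → X + Y ≡ X - - Y
    add≡sub-neg = solve-∀

  module FermatEquation {n} (n-oddPrime : OddPrime n) {a b c} (aⁿ-bⁿ≡cⁿ : a ^ n - b ^ n ≡ c ^ n) where

    module _ {p} (p-prime : Prime p) (p∣c : p ∣ ∣ c ∣) (p∤b : ¬ p ∣ ∣ b ∣) where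

      pⁿ∣aⁿ-bⁿ : ValGe p (a ^ n - b ^ n) n
      pⁿ∣aⁿ-bⁿ = subst (λ i → ValGe p i n) (sym aⁿ-bⁿ≡cⁿ) (valGe-^ n p∣c)

      p∤a : ¬ p ∣ ∣ a ∣
      p∤a p∣a with oddPrime⇒≡3+ n-oddPrime
      ... | m , refl = p∤b (prime∣i^k⇒prime∣i b n p-prime (∣⇒∣ᵤ {+ p} p∣bⁿ))
        where
        p∣bⁿ : + p ∣ℤ b ^ n
        p∣bⁿ = subst (+ p ∣ℤ_) (trans (cong (λ t → a ^ n - t) (sym aⁿ-bⁿ≡cⁿ)) (sub-sub (a ^ n) (b ^ n)))
                 (∣m∣n⇒∣m-n (∣m⇒∣m*n (a ^ (2 ℕ.+ m)) (∣∣⇒∣ℤ a p∣a)) (∣m⇒∣m*n (c ^ (2 ℕ.+ m)) (∣∣⇒∣ℤ c p∣c)))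
          where
          sub-sub : ∀ A B → A - (A - B) ≡ B
          sub-sub = solve-∀

      difference-bound : p ∣ ∣ a - b ∣ → ValGeBounds p n (a - b) n
      difference-bound p∣a-b = valGe-sub-^⇒valGe-sub {e = n} a b n-oddPrime p-prime p∣a-b p∤b pⁿ∣aⁿ-bⁿ

      wieferich-bound : ¬ 2 ∣ p → ValGeBounds p n (a ^ (p ∸ 1) - b ^ (p ∸ 1)) n
      wieferich-bound p-odd = wieferich-lift {e = n} a b n-oddPrime (p-prime , p-odd) p∤a p∤b pⁿ∣aⁿ-bⁿ

    parity-bound : 2 ∣ ∣ c ∣ → ¬ 2 ∣ ∣ b ∣ → ValGe 2 (a - b) n
    parity-bound 2∣c 2∤b = proj₁ (difference-bound prime[2] 2∣c 2∤b 2∣a-b) (proj₂ n-oddPrime)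
      where
      2∣a-b : 2 ∣ ∣ a - b ∣
      2∣a-b = ∣⇒∣ᵤ {+ 2} (∣[i-1]∧∣[j-1]⇒∣[i-j] a b (odd⇒2∣[i-1] a (p∤a prime[2] 2∣c 2∤b)) (odd⇒2∣[i-1] b 2∤b))

open import Defs
open import Data.Nat using (ℕ; _^_; _+_; _*_; _∸_; _<_)
open import Data.Nat.Divisibility using (_∣_; ∣m⇒∣m*n; ∣n⇒∣m*n)
open import Data.Nat.Primality using (Prime; prime[2])
open import Data.Nat.Coprimality using (Coprime) renaming (sym to sym⊥)
open import Data.Integer as ℤ using (+_)
open import Data.Integer.Properties using (∣-i∣≡∣i∣)
open import Data.Product using (_×_; _,_; proj₁; proj₂)
open import Function using (_∘_)
open import Relation.Nullary using (¬_)
open import Relation.Binary.PropositionalEquality using (_≡_; sym; subst)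
open PrimeDivisibility using (prime∣prime⇒≡; coprime∧prime∣m⇒∤n)
open PowerDifferences
  using (ValGeBounds; fermatEquation-rearranged; module FermatEquation; powDiff≡; powDiff≡-neg; pos-+≡sub-neg)

module PrimitiveSolution {n x y z} (n-oddPrime : OddPrime n) (x⊥y : Coprime x y) (y⊥z : Coprime y z)
                         (xⁿ+yⁿ≡zⁿ : x ^ n + y ^ n ≡ z ^ n) where

  private
    rearranged = fermatEquation-rearranged (proj₂ n-oddPrime) xⁿ+yⁿ≡zⁿ
    module X = FermatEquation n-oddPrime (proj₁ rearranged)
    module Y = FermatEquation n-oddPrime (proj₁ (proj₂ rearranged))
    module Z = FermatEquation n-oddPrime (proj₂ (proj₂ rearranged))

    p∤y : ∀ {p} → Prime p → p ∣ x → ¬ p ∣ y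
    p∤y p-prime = coprime∧prime∣m⇒∤n p-prime x⊥y

    p∤x : ∀ {p} → Prime p → p ∣ y → ¬ p ∣ x
    p∤x p-prime = coprime∧prime∣m⇒∤n p-prime (sym⊥ x⊥y)

    p∤-y : ∀ {p} → Prime p → p ∣ z → ¬ p ∣ ℤ.∣ ℤ.- (+ y) ∣
    p∤-y p-prime p∣z = subst (λ m → ¬ _ ∣ m) (sym (∣-i∣≡∣i∣ (+ y))) (coprime∧prime∣m⇒∤n p-prime (sym⊥ y⊥z) p∣z)

  x-wieferich : ∀ {p} → OddPrime p → p ∣ x → ValGeBounds p n (powDiff z y (p ∸ 1)) n
  x-wieferich {p} (p-prime , p-odd) p∣x = subst (λ i → ValGeBounds p n i n) (sym (powDiff≡ z y (p ∸ 1)))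
    (X.wieferich-bound p-prime p∣x (p∤y p-prime p∣x) p-odd)

  y-wieferich : ∀ {p} → OddPrime p → p ∣ y → ValGeBounds p n (powDiff z x (p ∸ 1)) n
  y-wieferich {p} (p-prime , p-odd) p∣y = subst (λ i → ValGeBounds p n i n) (sym (powDiff≡ z x (p ∸ 1)))
    (Y.wieferich-bound p-prime p∣y (p∤x p-prime p∣y) p-odd)

  z-wieferich : ∀ {p} → OddPrime p → p ∣ z → ValGeBounds p n (powDiff x y (p ∸ 1)) n
  z-wieferich {p} (p-prime , p-odd) p∣z = subst (λ i → ValGeBounds p n i n) (sym (powDiff≡-neg x y p-odd))
    (Z.wieferich-bound p-prime p∣z (p∤-y p-prime p∣z) p-odd)

  x-parity : 2 ∣ x → ValGe 2 (diff z y) n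
  x-parity 2∣x = X.parity-bound 2∣x (p∤y prime[2] 2∣x)

  y-parity : 2 ∣ y → ValGe 2 (diff z x) n
  y-parity 2∣y = Y.parity-bound 2∣y (p∤x prime[2] 2∣y)

  z-parity : 2 ∣ z → ValGe 2 (+ (x + y)) n
  z-parity 2∣z = subst (λ i → ValGe 2 i n) (sym (pos-+≡sub-neg x y)) (Z.parity-bound 2∣z (p∤-y prime[2] 2∣z))

  x-difference : ∀ {p} → Prime p → p ∣ x → p ∣ ℤ.∣ diff z y ∣ → ValGeBounds p n (diff z y) n
  x-difference p-prime p∣x = X.difference-bound p-prime p∣x (p∤y p-prime p∣x)

  y-difference : ∀ {p} → Prime p → p ∣ y → p ∣ ℤ.∣ diff z x ∣ → ValGeBounds p n (diff z x) n
  y-difference p-prime p∣y = Y.difference-bound p-prime p∣y (p∤x p-prime p∣y)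

  z-difference : ∀ {p} → Prime p → p ∣ z → p ∣ x + y → ValGeBounds p n (+ (x + y)) n
  z-difference {p} p-prime p∣z p∣x+y = subst (λ i → ValGeBounds p n i n) (sym (pos-+≡sub-neg x y))
    (Z.difference-bound p-prime p∣z (p∤-y p-prime p∣z) (subst (λ i → p ∣ ℤ.∣ i ∣) (pos-+≡sub-neg x y) p∣x+y))

theorem1p4 : (n x y z : ℕ) → OddPrime n → 0 < x → 0 < y → 0 < z
    → Coprime x y → Coprime y z → Coprime x z
    → x ^ n + y ^ n ≡ z ^ n
    → ((∀ p → OddPrime p → p ∣ x → ValGe p (powDiff z y (p ∸ 1)) (n ∸ 1))
    × (∀ p → OddPrime p → p ∣ y → ValGe p (powDiff z x (p ∸ 1)) (n ∸ 1))
    × (∀ p → OddPrime p → p ∣ z → ValGe p (powDiff x y (p ∸ 1)) (n ∸ 1)))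
    × (¬ (n ∣ x * y * z)
    → (∀ p → OddPrime p → p ∣ x → ValGe p (powDiff z y (p ∸ 1)) n)
    × (∀ p → OddPrime p → p ∣ y → ValGe p (powDiff z x (p ∸ 1)) n)
    × (∀ p → OddPrime p → p ∣ z → ValGe p (powDiff x y (p ∸ 1)) n))
    × ((2 ∣ z → ValGe 2 (+ (x + y)) n)
    × (2 ∣ x → ValGe 2 (diff z y) n)
    × (2 ∣ y → ValGe 2 (diff z x) n))
    × ((∀ p → OddPrime p → p ∣ x → p ∣ ℤ.∣ diff z y ∣ → ValGe p (diff z y) (n ∸ 1))
    × (∀ p → OddPrime p → p ∣ y → p ∣ ℤ.∣ diff z x ∣ → ValGe p (diff z x) (n ∸ 1))
    × (∀ p → OddPrime p → p ∣ z → p ∣ (x + y) → ValGe p (+ (x + y)) (n ∸ 1)))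
theorem1p4 n x y z n-oddPrime _ _ _ x⊥y y⊥z _ xⁿ+yⁿ≡zⁿ =
    ( (λ p p-odd p∣x → proj₂ (x-wieferich p-odd p∣x))
    , (λ p p-odd p∣y → proj₂ (y-wieferich p-odd p∣y))
    , (λ p p-odd p∣z → proj₂ (z-wieferich p-odd p∣z)) )
  , (λ n∤xyz →
      (λ p p-odd p∣x → proj₁ (x-wieferich p-odd p∣x) (p∤n n∤xyz p-odd (∣m⇒∣m*n z (∣m⇒∣m*n y p∣x))))
    , (λ p p-odd p∣y → proj₁ (y-wieferich p-odd p∣y) (p∤n n∤xyz p-odd (∣m⇒∣m*n z (∣n⇒∣m*n x p∣y))))
    , (λ p p-odd p∣z → proj₁ (z-wieferich p-odd p∣z) (p∤n n∤xyz p-odd (∣n⇒∣m*n (x * y) p∣z))))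
  , (z-parity , x-parity , y-parity)
  , ( (λ p p-odd p∣x → proj₂ ∘ x-difference (proj₁ p-odd) p∣x)
    , (λ p p-odd p∣y → proj₂ ∘ y-difference (proj₁ p-odd) p∣y)
    , (λ p p-odd p∣z → proj₂ ∘ z-difference (proj₁ p-odd) p∣z) )
  where
  open PrimitiveSolution n-oddPrime x⊥y y⊥z xⁿ+yⁿ≡zⁿ
  p∤n : ¬ n ∣ x * y * z → ∀ {p} → OddPrime p → p ∣ x * y * z → ¬ p ∣ n
  p∤n n∤xyz (p-prime , _) p∣xyz p∣n =
    n∤xyz (subst (_∣ x * y * z) (prime∣prime⇒≡ p-prime (proj₁ n-oddPrime) p∣n) p∣xyz)
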